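{- (1) For all $n\ge1$, the highest power of $x$ appearing in $A_{2n}(x)$ is $x^{2n-1}$, with coefficient $B_{2n-1}(1)$. (2) For all $n\ge1$, the highest power of $x$ appearing in $B_{2n+1}(x)$ is $x^{2n-1}$, with coefficient $(2n)B_{2n-1}(1)$. (3) For all $n\ge1$, the highest power of $x$ appearing in $C_{2n}(x)$ is $x^{2n-2}$, with coefficient $(2n-1)A_{2n-2}(1)$. (4) For all $n\ge1$, the highest power of $x$ appearing in $D_{2n+1}(x)$ is $x^{2n}$, with coefficient $A_{2n}(1)$.
   Context: For $\sigma=\sigma_1\ldots\sigma_n\in S_n$, let $\mathrm{mmp}^{(1,0,0,0)}(\sigma)$ be the number of indices $i$ such that there exists $j>i$ with $\sigma_j>\sigma_i$. $UD_n$ is the set of up-down permutations in $S_n$ ($\sigma_1<\sigma_2>\sigma_3<\cdots$) and $DU_n$ the set of down-up permutations ($\sigma_1>\sigma_2<\sigma_3>\cdots$). For $m\ge1$: $A_{2m}(x)=\sum_{\sigma\in UD_{2m}}x^{\mathrm{mmp}^{(1,0,0,0)}(\sigma)}$, $B_{2m-1}(x)=\sum_{\sigma\in UD_{2m-1}}x^{\mathrm{mmp}^{(1,0,0,0)}(\sigma)}$, $C_{2m}(x)=\sum_{\sigma\in DU_{2m}}x^{\mathrm{mmp}^{(1,0,0,0)}(\sigma)}$, $D_{2m-1}(x)=\sum_{\sigma\in DU_{2m-1}}x^{\mathrm{mmp}^{(1,0,0,0)}(\sigma)}$; also $A_0(x)=1$. Thus $A_{2m}(1)=|UD_{2m}|$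 and $B_{2m-1}(1)=|UD_{2m-1}|$. -}

module Defs where

open import Data.Nat using (ℕ; zero; suc; _+_; _*_; _∸_; _<_; _<ᵇ_; _≡ᵇ_)
open import Data.Bool using (Bool; true; false; _∧_; _∨_; not; if_then_else_)
open import Data.List using (List; []; _∷_; map; concatMap; upTo; filter; length)
open import Data.Bool.ListAction using (any)
open import Data.Product using (_×_)
open import Relation.Binary.PropositionalEquality using (_≡_; _≢_)
open import Relation.Nullary.Decidable using (T?)

words : ℕ → ℕ → List (List ℕ)
words k zero    = [] ∷ []
words k (suc l) = concatMap (λ w → map (_∷ w) (upTo k)) (words k l)

elemᵇ : ℕ → List ℕ → Bool
elemᵇ x []       = false
elemᵇ x (y ∷ ys) = (x ≡ᵇ y) ∨ elemᵇ x ys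

distinct : List ℕ → Bool
distinct []       = true
distinct (x ∷ xs) = not (elemᵇ x xs) ∧ distinct xs

-- S_n : permutations of {0,…,n-1} in one-line notation σ₁…σₙ
-- (values shifted by -1 relative to {1,…,n}; irrelevant for the statistics below).
perms : ℕ → List (List ℕ)
perms n = filter (λ w → T? (distinct w)) (words n n)

mutual
  isUD : List ℕ → Bool
  isUD (x ∷ y ∷ rest) = (x <ᵇ y) ∧ isDU (y ∷ rest)
  isUD _              = true

  isDU : List ℕ → Bool
  isDU (x ∷ y ∷ rest) = (y <ᵇ x) ∧ isUD (y ∷ rest)
  isDU _              = true

mmp : List ℕ → ℕ
mmp []       = 0
mmp (x ∷ xs) = (if any (λ y → x <ᵇ y) xs then 1 else 0) + mmp xs

coeff : (List ℕ → Bool) → ℕ → ℕ → ℕ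
coeff P n k = length (filter (λ σ → mmp σ Data.Nat.≟ k) (filter (λ σ → T? (P σ)) (perms n)))
  where import Data.Nat

-- Value at x = 1 of that polynomial: #{σ ∈ S_n : P σ}.
count : (List ℕ → Bool) → ℕ → ℕ
count P n = length (filter (λ σ → T? (P σ)) (perms n))

-- A_{2m}, B_{2m-1} (over UD) and C_{2m}, D_{2m-1} (over DU), as coefficient functions.
-- polyUD n k = [x^k] Σ_{σ∈UD_n} x^{mmp σ},  polyDU n k = [x^k] Σ_{σ∈DU_n} x^{mmp σ}.
polyUD : ℕ → ℕ → ℕ
polyUD = coeff isUD

polyDU : ℕ → ℕ → ℕ
polyDU = coeff isDU

-- |UD_n| = A_n(1) or B_n(1) depending on parity.
udCount : ℕ → ℕ
udCount = count isUD

HighestTerm : (ℕ → ℕ) → ℕ → ℕ → Set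
HighestTerm f d c = (f d ≡ c) × (c ≢ 0) × (∀ k → d < k → f k ≡ 0)

-- mmp σ counts the positions of σ that are not right-to-left maxima. The last
-- position never counts, so mmp σ ≤ n - 1, with equality iff σ ends in its maximum.
-- When an alternating permutation may end with an ascent (A_{2n}, D_{2n+1}) this is
-- the top degree, and deleting the final maximum is a bijection onto the alternating
-- permutations of the same kind that are one shorter. When it must end with a descent
-- (B_{2n+1}, C_{2n}) the last two positions never count, so mmp σ ≤ n - 2, with
-- equality iff the maximum sits in position n - 1; such σ consist of a relabelled
-- alternating permutation of length n - 2, the maximum, and any of the n - 1 other
-- letters. Complementation v ↦ n - 1 - v exchanges up-down and down-up permutations.
-- Permutations are distinct words, and every count is a sum of weights over all
-- words of length n over {0, …, n - 1}.

module Submission where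

open import Defs
open import Data.Nat.Properties
open import Algebra.Properties.CommutativeSemigroup +-commutativeSemigroup using (interchange)
open import Data.Bool using (Bool; true; false; T; _∧_; _∨_; not; if_then_else_)
open import Data.Bool.ListAction using (any)
open import Data.Bool.Properties
  using (T-≡; ¬-not; not-injective; ∨-assoc; ∨-identityʳ; ∨-zeroʳ; ∨-conicalˡ; ∨-conicalʳ;
         ∧-assoc; ∧-identityʳ; ∧-conicalˡ; ∧-conicalʳ)
open import Data.Empty using (⊥; ⊥-elim)
open import Data.List using (List; []; _∷_; [_]; _++_; map; concat; concatMap; applyUpTo; filter; length)
open import Data.List.Properties using (length-++; length-map; ++-assoc; ∷ʳ-++)
open import Data.List.Relation.Unary.All as All using (All; []; _∷_)
open import Data.List.Relation.Unary.All.Properties using (++⁺; map⁺)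
open import Data.Nat
open import Data.Product using (_×_; _,_)
open import Function using (_∘_; const; id; Equivalence)
open import Relation.Binary.Definitions using (tri<; tri≈; tri>)
open import Relation.Binary.PropositionalEquality hiding ([_])
open import Relation.Nullary using (Dec; does; yes; no)
open import Relation.Nullary.Decidable using (T?)
open import Relation.Unary using (U)

𝟙 : Bool → ℕ
𝟙 b = if b then 1 else 0

module _ {m n : ℕ} where

  <ᵇ-true : m < n → (m <ᵇ n) ≡ true
  <ᵇ-true = Equivalence.to T-≡ ∘ <⇒<ᵇ

  <ᵇ-false : n ≤ m → (m <ᵇ n) ≡ false
  <ᵇ-false n≤m = ¬-not (λ e → <⇒≱ (<ᵇ⇒< m n (Equivalence.from T-≡ e)) n≤m)

  <ᵇ-true⇒< : (m <ᵇ n) ≡ true → m < n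
  <ᵇ-true⇒< = <ᵇ⇒< m n ∘ Equivalence.from T-≡

  <ᵇ-false⇒≥ : (m <ᵇ n) ≡ false → n ≤ m
  <ᵇ-false⇒≥ e = ≮⇒≥ (λ m<n → subst T e (<⇒<ᵇ m<n))

  ≡ᵇ-false : m ≢ n → (m ≡ᵇ n) ≡ false
  ≡ᵇ-false m≢n = ¬-not (λ e → m≢n (≡ᵇ⇒≡ m n (Equivalence.from T-≡ e)))

  ≡ᵇ-true⇒≡ : (m ≡ᵇ n) ≡ true → m ≡ n
  ≡ᵇ-true⇒≡ = ≡ᵇ⇒≡ m n ∘ Equivalence.from T-≡

<ᵇ-irrefl : ∀ n → (n <ᵇ n) ≡ false
<ᵇ-irrefl n = <ᵇ-false {n} {n} ≤-refl

≡ᵇ-refl : ∀ n → (n ≡ᵇ n) ≡ true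
≡ᵇ-refl n = Equivalence.to T-≡ (≡⇒≡ᵇ n n refl)

≡ᵇ-sym : ∀ m n → (m ≡ᵇ n) ≡ (n ≡ᵇ m)
≡ᵇ-sym zero    zero    = refl
≡ᵇ-sym zero    (suc n) = refl
≡ᵇ-sym (suc m) zero    = refl
≡ᵇ-sym (suc m) (suc n) = ≡ᵇ-sym m n

𝟙≤1 : ∀ b → 𝟙 b ≤ 1
𝟙≤1 true  = ≤-refl
𝟙≤1 false = z≤n

-- Membership and distinctness

elemᵇ-here : ∀ a w → elemᵇ a (a ∷ w) ≡ true
elemᵇ-here a w rewrite ≡ᵇ-refl a = refl

elemᵇ-there : ∀ a x w → elemᵇ a w ≡ true → elemᵇ a (x ∷ w) ≡ true
elemᵇ-there a x w a∈w rewrite a∈w = ∨-zeroʳ (a ≡ᵇ x)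

elemᵇ-++ : ∀ a u v → elemᵇ a (u ++ v) ≡ (elemᵇ a u ∨ elemᵇ a v)
elemᵇ-++ a []      v = refl
elemᵇ-++ a (x ∷ u) v = trans (cong ((a ≡ᵇ x) ∨_) (elemᵇ-++ a u v)) (sym (∨-assoc (a ≡ᵇ x) _ _))

elemᵇ-++ˡ : ∀ a u v → elemᵇ a u ≡ true → elemᵇ a (u ++ v) ≡ true
elemᵇ-++ˡ a u v a∈u rewrite elemᵇ-++ a u v | a∈u = refl

elemᵇ-++ʳ : ∀ a u v → elemᵇ a v ≡ true → elemᵇ a (u ++ v) ≡ true
elemᵇ-++ʳ a u v a∈v rewrite elemᵇ-++ a u v | a∈v = ∨-zeroʳ (elemᵇ a u)

elemᵇ-++-∉ : ∀ a u v → elemᵇ a v ≡ false → elemᵇ a (u ++ v) ≡ elemᵇ a u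
elemᵇ-++-∉ a u v a∉v = trans (elemᵇ-++ a u v) (trans (cong (elemᵇ a u ∨_) a∉v) (∨-identityʳ _))

elemᵇ-false⇒All≢ : ∀ a w → elemᵇ a w ≡ false → All (_≢ a) w
elemᵇ-false⇒All≢ a []      _   = []
elemᵇ-false⇒All≢ a (x ∷ w) a∉w =
  (λ x≡a → subst T (∨-conicalˡ _ _ a∉w) (≡⇒≡ᵇ a x (sym x≡a)))
  ∷ elemᵇ-false⇒All≢ a w (∨-conicalʳ _ _ a∉w)

All≢⇒elemᵇ-false : ∀ {a w} → All (_≢ a) w → elemᵇ a w ≡ false
All≢⇒elemᵇ-false []                = refl
All≢⇒elemᵇ-false (x≢a ∷ w≢a) rewrite ≡ᵇ-false (x≢a ∘ sym) = All≢⇒elemᵇ-false w≢a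

All<-strengthen : ∀ m w → All (_< suc m) w → elemᵇ m w ≡ false → All (_< m) w
All<-strengthen m w w≤m m∉w = All.zipWith (λ (x≤m , x≢m) → ≤∧≢⇒< (≤-pred x≤m) x≢m)
                                          (w≤m , elemᵇ-false⇒All≢ m w m∉w)

distinct-∷ʳ : ∀ a w → distinct (w ++ [ a ]) ≡ (not (elemᵇ a w) ∧ distinct w)
distinct-∷ʳ a []      = refl
distinct-∷ʳ a (x ∷ w) rewrite elemᵇ-++ x w [ a ] | distinct-∷ʳ a w | ≡ᵇ-sym a x =
  shuffle (elemᵇ x w) (x ≡ᵇ a) (elemᵇ a w) (distinct w)
  where
  shuffle : ∀ p q r s → (not (p ∨ (q ∨ false)) ∧ (not r ∧ s)) ≡ (not (q ∨ r) ∧ (not p ∧ s))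
  shuffle true  true  r     s = refl
  shuffle true  false true  s = refl
  shuffle true  false false s = refl
  shuffle false true  r     s = refl
  shuffle false false true  s = refl
  shuffle false false false s = refl

distinct-++-∷⇒∉ : ∀ a w t → distinct (w ++ a ∷ t) ≡ true → elemᵇ a w ≡ false
distinct-++-∷⇒∉ a []      t _ = refl
distinct-++-∷⇒∉ a (z ∷ w) t d with a ≡ᵇ z in a≡ᵇz
... | false = distinct-++-∷⇒∉ a w t (∧-conicalʳ _ _ d)
... | true  = ⊥-elim (subst T (not-injective (∧-conicalˡ _ _ d)) z∈)
  where
  z∈ : T (elemᵇ z (w ++ a ∷ t))
  z∈ = subst (λ b → T (elemᵇ z (w ++ b ∷ t))) (sym (≡ᵇ-true⇒≡ a≡ᵇz))
             (Equivalence.from T-≡ (elemᵇ-++ʳ z w (z ∷ t) (elemᵇ-here z t)))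

distinct-++⇒distinctʳ : ∀ u v → distinct (u ++ v) ≡ true → distinct v ≡ true
distinct-++⇒distinctʳ []      v d = d
distinct-++⇒distinctʳ (x ∷ u) v d = distinct-++⇒distinctʳ u v (∧-conicalʳ _ _ d)

distinct-++-max-∷ : ∀ {a y} w → All (_< a) w → y < a → elemᵇ y w ≡ false →
                    distinct (w ++ a ∷ [ y ]) ≡ distinct w
distinct-++-max-∷ {a} {y} w w<a y<a y∉w
  rewrite sym (∷ʳ-++ w a [ y ]) | distinct-∷ʳ y (w ++ [ a ]) | elemᵇ-++ y w [ a ] | y∉w | ≡ᵇ-false (<⇒≢ y<a)
        | distinct-∷ʳ a w | All≢⇒elemᵇ-false {a} (All.map <⇒≢ w<a) = refl

-- Finite sums

∑ : ℕ → (ℕ → ℕ) → ℕ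
∑ zero    h = 0
∑ (suc k) h = h 0 + ∑ k (h ∘ suc)

∑-cong : ∀ k {g h : ℕ → ℕ} → (∀ x → x < k → g x ≡ h x) → ∑ k g ≡ ∑ k h
∑-cong zero    eq = refl
∑-cong (suc k) eq = cong₂ _+_ (eq 0 z<s) (∑-cong k (λ x x<k → eq (suc x) (s<s x<k)))

∑-const : ∀ k c → ∑ k (const c) ≡ k * c
∑-const zero    c = refl
∑-const (suc k) c = cong (c +_) (∑-const k c)

∑-zero : ∀ k h → (∀ x → x < k → h x ≡ 0) → ∑ k h ≡ 0
∑-zero k h h≡0 = trans (∑-cong k h≡0) (trans (∑-const k 0) (*-zeroʳ k))

∑-+ : ∀ k g h → ∑ k (λ x → g x + h x) ≡ ∑ k g + ∑ k h
∑-+ zero    g h = refl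
∑-+ (suc k) g h = trans (cong (g 0 + h 0 +_) (∑-+ k (g ∘ suc) (h ∘ suc)))
                        (interchange (g 0) (h 0) _ _)

∑-comm : ∀ a b (f : ℕ → ℕ → ℕ) → ∑ a (λ x → ∑ b (f x)) ≡ ∑ b (λ y → ∑ a (λ x → f x y))
∑-comm zero    b f = sym (∑-zero b _ (λ _ _ → refl))
∑-comm (suc a) b f = trans (cong (∑ b (f 0) +_) (∑-comm a b (f ∘ suc)))
                           (sym (∑-+ b (f 0) (λ y → ∑ a (λ x → f (suc x) y))))

∑-suc : ∀ k h → ∑ (suc k) h ≡ ∑ k h + h k
∑-suc zero    h = +-comm (h 0) 0
∑-suc (suc k) h = trans (cong (h 0 +_) (∑-suc k (h ∘ suc))) (sym (+-assoc (h 0) _ _))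

∑-last : ∀ k h → (∀ x → x < k → h x ≡ 0) → ∑ (suc k) h ≡ h k
∑-last k h h≡0 = trans (∑-suc k h) (cong (_+ h k) (∑-zero k h h≡0))

≤-∑ : ∀ k h {x} → x < k → h x ≤ ∑ k h
≤-∑ (suc k) h {zero}  _         = m≤m+n (h 0) _
≤-∑ (suc k) h {suc x} (s<s x<k) = ≤-trans (≤-∑ k (h ∘ suc) x<k) (m≤n+m _ (h 0))

∑-reverse : ∀ k h → ∑ k h ≡ ∑ k (λ x → h (k ∸ suc x))
∑-reverse zero    h = refl
∑-reverse (suc k) h = begin
    h 0 + ∑ k (h ∘ suc)                       ≡⟨ cong (h 0 +_) (∑-reverse k (h ∘ suc)) ⟩
    h 0 + ∑ k (λ x → h (suc (k ∸ suc x)))     ≡⟨ +-comm (h 0) _ ⟩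
    ∑ k (λ x → h (suc (k ∸ suc x))) + h 0     ≡⟨ cong₂ _+_ (∑-cong k (λ x x<k → cong h (sym (+-∸-assoc 1 x<k))))
                                                           (cong h (sym (n∸n≡0 k))) ⟩
    ∑ k (λ x → h (k ∸ x)) + h (k ∸ k)         ≡⟨ sym (∑-suc k (λ x → h (k ∸ x))) ⟩
    ∑ (suc k) (λ x → h (suc k ∸ suc x))       ∎
  where open ≡-Reasoning

punchIn : ℕ → ℕ → ℕ
punchIn c x = if x <ᵇ c then x else suc x

punchIn-suc : ∀ c x → punchIn (suc c) (suc x) ≡ suc (punchIn c x)
punchIn-suc c x with x <ᵇ c
... | true  = refl
... | false = refl

∑-punchIn : ∀ {c k} h → c ≤ k → ∑ (suc k) h ≡ ∑ k (h ∘ punchIn c) + h c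
∑-punchIn {zero}           h _          = +-comm (h 0) _
∑-punchIn {suc c} {suc k} h (s≤s c≤k) = begin
    h 0 + ∑ (suc k) (h ∘ suc)                              ≡⟨ cong (h 0 +_) (∑-punchIn (h ∘ suc) c≤k) ⟩
    h 0 + (∑ k (h ∘ suc ∘ punchIn c) + h (suc c))          ≡⟨ sym (+-assoc (h 0) _ _) ⟩
    h 0 + ∑ k (h ∘ suc ∘ punchIn c) + h (suc c)            ≡⟨ cong (λ s → h 0 + s + h (suc c))
                                                                   (∑-cong k (λ x _ → cong h (sym (punchIn-suc c x)))) ⟩
    h 0 + ∑ k (h ∘ punchIn (suc c) ∘ suc) + h (suc c)      ∎
  where open ≡-Reasoning

punchIn-below : ∀ {k} w → All (_< k) w → map (punchIn k) w ≡ w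
punchIn-below []      []           = refl
punchIn-below (x ∷ w) (x<k ∷ w<k) rewrite <ᵇ-true x<k = cong (x ∷_) (punchIn-below w w<k)

∑ₗ : (List ℕ → ℕ) → List (List ℕ) → ℕ
∑ₗ g []       = 0
∑ₗ g (w ∷ ws) = g w + ∑ₗ g ws

∑ₗ-cong : ∀ {g h : List ℕ → ℕ} ws → (∀ w → g w ≡ h w) → ∑ₗ g ws ≡ ∑ₗ h ws
∑ₗ-cong []       eq = refl
∑ₗ-cong (w ∷ ws) eq = cong₂ _+_ (eq w) (∑ₗ-cong ws eq)

∑ₗ-zero : ∀ ws → ∑ₗ (const 0) ws ≡ 0
∑ₗ-zero []       = refl
∑ₗ-zero (w ∷ ws) = ∑ₗ-zero ws

∑ₗ-++ : ∀ g us vs → ∑ₗ g (us ++ vs) ≡ ∑ₗ g us + ∑ₗ g vs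
∑ₗ-++ g []       vs = refl
∑ₗ-++ g (u ∷ us) vs = trans (cong (g u +_) (∑ₗ-++ g us vs)) (sym (+-assoc (g u) _ _))

∑ₗ-concatMap : ∀ g (f : List ℕ → List (List ℕ)) ws → ∑ₗ g (concatMap f ws) ≡ ∑ₗ (∑ₗ g ∘ f) ws
∑ₗ-concatMap g f []       = refl
∑ₗ-concatMap g f (w ∷ ws) = trans (∑ₗ-++ g (f w) (concat (map f ws)))
                                 (cong (∑ₗ g (f w) +_) (∑ₗ-concatMap g f ws))

∑ₗ-map-applyUpTo : ∀ g (f : ℕ → List ℕ) h k → ∑ₗ g (map f (applyUpTo h k)) ≡ ∑ k (g ∘ f ∘ h)
∑ₗ-map-applyUpTo g f h zero    = refl
∑ₗ-map-applyUpTo g f h (suc k) = cong (g (f (h 0)) +_) (∑ₗ-map-applyUpTo g f (h ∘ suc) k)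

∑ₗ-∑-comm : ∀ k (f : ℕ → List ℕ → ℕ) ws → ∑ₗ (λ w → ∑ k (λ y → f y w)) ws ≡ ∑ k (λ y → ∑ₗ (f y) ws)
∑ₗ-∑-comm k f []       = sym (∑-zero k _ (λ _ _ → refl))
∑ₗ-∑-comm k f (w ∷ ws) = trans (cong (∑ k (λ y → f y w) +_) (∑ₗ-∑-comm k f ws))
                               (sym (∑-+ k (λ y → f y w) (λ y → ∑ₗ (f y) ws)))

∑ₗ-filter : ∀ {P : List ℕ → Set} (P? : ∀ w → Dec (P w)) g ws →
            ∑ₗ g (filter P? ws) ≡ ∑ₗ (λ w → if does (P? w) then g w else 0) ws
∑ₗ-filter P? g []       = refl
∑ₗ-filter P? g (w ∷ ws) with does (P? w)
... | true  = cong (g w +_) (∑ₗ-filter P? g ws)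
... | false = ∑ₗ-filter P? g ws

length≡∑ₗ1 : ∀ ws → length ws ≡ ∑ₗ (const 1) ws
length≡∑ₗ1 []       = refl
length≡∑ₗ1 (w ∷ ws) = cong suc (length≡∑ₗ1 ws)

-- Sums over all words of a given length

∑-words-∷ : ∀ g k l → ∑ₗ g (words k (suc l)) ≡ ∑ₗ (λ w → ∑ k (λ x → g (x ∷ w))) (words k l)
∑-words-∷ g k l = trans (∑ₗ-concatMap g (λ w → map (_∷ w) (applyUpTo id k)) (words k l))
                        (∑ₗ-cong (words k l) (λ w → ∑ₗ-map-applyUpTo g (_∷ w) id k))

∑-words-∷ʳ : ∀ g k l → ∑ₗ g (words k (suc l)) ≡ ∑ₗ (λ w → ∑ k (λ x → g (w ++ [ x ]))) (words k l)
∑-words-∷ʳ g k zero    = ∑-words-∷ g k zero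
∑-words-∷ʳ g k (suc l) = begin
    ∑ₗ g (words k (suc (suc l)))                                  ≡⟨ ∑-words-∷ g k (suc l) ⟩
    ∑ₗ g′ (words k (suc l))                                        ≡⟨ ∑-words-∷ʳ g′ k l ⟩
    ∑ₗ (λ w → ∑ k (λ y → g′ (w ++ [ y ]))) (words k l)            ≡⟨ ∑ₗ-cong (words k l) (λ w →
                                                                        ∑-comm k k (λ y x → g (x ∷ w ++ [ y ]))) ⟩
    ∑ₗ (λ w → ∑ k (λ x → g″ (x ∷ w))) (words k l)                 ≡⟨ ∑-words-∷ g″ k l ⟨
    ∑ₗ g″ (words k (suc l))                                        ∎
  where
  open ≡-Reasoning
  g′ = λ w → ∑ k (λ x → g (x ∷ w))
  g″ = λ w → ∑ k (λ x → g (w ++ [ x ]))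

∑-words-∷ʳ-∷ʳ : ∀ g k l → ∑ₗ g (words k (suc (suc l))) ≡
                           ∑ₗ (λ w → ∑ k (λ x → ∑ k (λ y → g (w ++ x ∷ [ y ])))) (words k l)
∑-words-∷ʳ-∷ʳ g k l = begin
    ∑ₗ g (words k (suc (suc l)))                                            ≡⟨ ∑-words-∷ʳ g k (suc l) ⟩
    ∑ₗ (λ v → ∑ k (λ y → g (v ++ [ y ]))) (words k (suc l))                 ≡⟨ ∑-words-∷ʳ _ k l ⟩
    ∑ₗ (λ w → ∑ k (λ x → ∑ k (λ y → g ((w ++ [ x ]) ++ [ y ])))) (words k l) ≡⟨ ∑ₗ-cong (words k l) (λ w →
                                                                                 ∑-cong k (λ x _ → ∑-cong k (λ y _ →
                                                                                   cong g (++-assoc w [ x ] [ y ])))) ⟩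
    ∑ₗ (λ w → ∑ k (λ x → ∑ k (λ y → g (w ++ x ∷ [ y ])))) (words k l)      ∎
  where open ≡-Reasoning

∑-words-cong : ∀ k l {g h : List ℕ → ℕ} → (∀ w → length w ≡ l → All (_< k) w → g w ≡ h w) →
               ∑ₗ g (words k l) ≡ ∑ₗ h (words k l)
∑-words-cong k zero    eq = cong (_+ 0) (eq [] refl [])
∑-words-cong k (suc l) {g} {h} eq = begin
    ∑ₗ g (words k (suc l))                      ≡⟨ ∑-words-∷ g k l ⟩
    ∑ₗ (λ w → ∑ k (λ x → g (x ∷ w))) (words k l) ≡⟨ ∑-words-cong k l (λ w |w| w<k →
                                                      ∑-cong k (λ x x<k → eq (x ∷ w) (cong suc |w|) (x<k ∷ w<k))) ⟩
    ∑ₗ (λ w → ∑ k (λ x → h (x ∷ w))) (words k l) ≡⟨ ∑-words-∷ h k l ⟨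
    ∑ₗ h (words k (suc l))                      ∎
  where open ≡-Reasoning

∑-words-punchIn : ∀ {c k} l g → c ≤ k → (∀ w → elemᵇ c w ≡ true → g w ≡ 0) →
                  ∑ₗ g (words (suc k) l) ≡ ∑ₗ (g ∘ map (punchIn c)) (words k l)
∑-words-punchIn         zero    g c≤k g≡0 = refl
∑-words-punchIn {c} {k} (suc l) g c≤k g≡0 = begin
    ∑ₗ g (words (suc k) (suc l))                                ≡⟨ ∑-words-∷ g (suc k) l ⟩
    ∑ₗ g′ (words (suc k) l)                                      ≡⟨ ∑-words-punchIn l g′ c≤k g′≡0 ⟩
    ∑ₗ (g′ ∘ map (punchIn c)) (words k l)                        ≡⟨ ∑ₗ-cong (words k l) drop-c ⟩
    ∑ₗ (λ w → ∑ k (λ x → g (map (punchIn c) (x ∷ w)))) (words k l) ≡⟨ ∑-words-∷ (g ∘ map (punchIn c)) k l ⟨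
    ∑ₗ (g ∘ map (punchIn c)) (words k (suc l))                   ∎
  where
  open ≡-Reasoning
  g′ = λ w → ∑ (suc k) (λ x → g (x ∷ w))
  g′≡0 : ∀ w → elemᵇ c w ≡ true → g′ w ≡ 0
  g′≡0 w c∈w = ∑-zero (suc k) _ (λ x _ → g≡0 (x ∷ w) (elemᵇ-there c x w c∈w))
  drop-c : ∀ w → g′ (map (punchIn c) w) ≡ ∑ k (λ x → g (punchIn c x ∷ map (punchIn c) w))
  drop-c w = trans (∑-punchIn (λ x → g (x ∷ w′)) c≤k)
                   (trans (cong (∑ k (λ x → g (punchIn c x ∷ w′)) +_) (g≡0 (c ∷ w′) (elemᵇ-here c w′))) (+-identityʳ _))
    where w′ = map (punchIn c) w

∑-words-restrict : ∀ k l g → (∀ w → elemᵇ k w ≡ true → g w ≡ 0) →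
                   ∑ₗ g (words (suc k) l) ≡ ∑ₗ g (words k l)
∑-words-restrict k l g g≡0 = trans (∑-words-punchIn l g ≤-refl g≡0)
                                   (∑-words-cong k l (λ w _ w<k → cong g (punchIn-below w w<k)))

∑-words-reverse : ∀ k l g → ∑ₗ g (words k l) ≡ ∑ₗ (g ∘ map (λ v → k ∸ suc v)) (words k l)
∑-words-reverse k zero    g = refl
∑-words-reverse k (suc l) g = begin
    ∑ₗ g (words k (suc l))                                      ≡⟨ ∑-words-∷ g k l ⟩
    ∑ₗ g′ (words k l)                                            ≡⟨ ∑-words-reverse k l g′ ⟩
    ∑ₗ (g′ ∘ map r) (words k l)                                  ≡⟨ ∑ₗ-cong (words k l) (λ w → ∑-reverse k _) ⟩
    ∑ₗ (λ w → ∑ k (λ x → g (map r (x ∷ w)))) (words k l)         ≡⟨ ∑-words-∷ (g ∘ map r) k l ⟨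
    ∑ₗ (g ∘ map r) (words k (suc l))                             ∎
  where
  open ≡-Reasoning
  r = λ v → k ∸ suc v
  g′ = λ w → ∑ k (λ x → g (x ∷ w))

≤-∑-words : ∀ k l g {w} → length w ≡ l → All (_< k) w → g w ≤ ∑ₗ g (words k l)
≤-∑-words k zero    g {[]}    _   []            = m≤m+n (g []) 0
≤-∑-words k (suc l) g {x ∷ w} |w| (x<k ∷ w<k) = subst (g (x ∷ w) ≤_) (sym (∑-words-∷ g k l))
  (≤-trans (≤-∑ k (λ y → g (y ∷ w)) x<k)
           (≤-∑-words k l (λ v → ∑ k (λ y → g (y ∷ v))) (suc-injective |w|) w<k))

countWeight : (List ℕ → Bool) → List ℕ → ℕ
countWeight P σ = if distinct σ then 𝟙 (P σ) else 0

coeffWeight : (List ℕ → Bool) → ℕ → List ℕ → ℕ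
coeffWeight P t σ = if distinct σ then (if P σ then 𝟙 (mmp σ ≡ᵇ t) else 0) else 0

count≡∑-words : ∀ P n → count P n ≡ ∑ₗ (countWeight P) (words n n)
count≡∑-words P n = begin
    length (filter isP? perms′)       ≡⟨ length≡∑ₗ1 (filter isP? perms′) ⟩
    ∑ₗ (const 1) (filter isP? perms′) ≡⟨ ∑ₗ-filter isP? (const 1) perms′ ⟩
    ∑ₗ (𝟙 ∘ P) perms′                 ≡⟨ ∑ₗ-filter distinct? (𝟙 ∘ P) (words n n) ⟩
    ∑ₗ (countWeight P) (words n n)    ∎
  where
  open ≡-Reasoning
  distinct? = λ σ → T? (distinct σ)
  isP? = λ σ → T? (P σ)
  perms′ = filter distinct? (words n n)

coeff≡∑-words : ∀ P n t → coeff P n t ≡ ∑ₗ (coeffWeight P t) (words n n)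
coeff≡∑-words P n t = begin
    length (filter mmp≟t Ps)
      ≡⟨ length≡∑ₗ1 (filter mmp≟t Ps) ⟩
    ∑ₗ (const 1) (filter mmp≟t Ps)
      ≡⟨ ∑ₗ-filter mmp≟t (const 1) Ps ⟩
    ∑ₗ (λ σ → 𝟙 (mmp σ ≡ᵇ t)) Ps
      ≡⟨ ∑ₗ-filter isP? (λ σ → 𝟙 (mmp σ ≡ᵇ t)) perms′ ⟩
    ∑ₗ (λ σ → if P σ then 𝟙 (mmp σ ≡ᵇ t) else 0) perms′
      ≡⟨ ∑ₗ-filter distinct? (λ σ → if P σ then 𝟙 (mmp σ ≡ᵇ t) else 0) (words n n) ⟩
    ∑ₗ (coeffWeight P t) (words n n) ∎
  where
  open ≡-Reasoning
  distinct? = λ σ → T? (distinct σ)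
  isP? = λ σ → T? (P σ)
  mmp≟t = λ σ → mmp σ ≟ t
  perms′ = filter distinct? (words n n)
  Ps = filter isP? perms′

coeffWeight-≢ : ∀ P t σ → (distinct σ ≡ true → P σ ≡ true → mmp σ ≢ t) → coeffWeight P t σ ≡ 0
coeffWeight-≢ P t σ mmp≢t with distinct σ | P σ
... | false | _     = refl
... | true  | false = refl
... | true  | true  rewrite ≡ᵇ-false (mmp≢t refl refl) = refl

coeffWeight-≡ : ∀ P t σ → (distinct σ ≡ true → mmp σ ≡ t) → coeffWeight P t σ ≡ countWeight P σ
coeffWeight-≡ P t σ mmp≡t with distinct σ
... | false = refl
... | true  rewrite mmp≡t refl | ≡ᵇ-refl t with P σ
...   | false = refl
...   | true  = refl

countWeight-¬distinct : ∀ P σ → (distinct σ ≡ true → ⊥) → countWeight P σ ≡ 0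
countWeight-¬distinct P σ ¬d with distinct σ
... | true  = ⊥-elim (¬d refl)
... | false = refl

-- Relabelling by monotone maps

StrictlyIncreasingOn : (ℕ → Set) → (ℕ → ℕ) → Set
StrictlyIncreasingOn Q f = ∀ {a b} → Q a → Q b → a < b → f a < f b

StrictlyDecreasingOn : (ℕ → Set) → (ℕ → ℕ) → Set
StrictlyDecreasingOn Q f = ∀ {a b} → Q a → Q b → a < b → f b < f a

InjectiveOn : (ℕ → Set) → (ℕ → ℕ) → Set
InjectiveOn Q f = ∀ {a b} → Q a → Q b → f a ≡ f b → a ≡ b

module _ {Q : ℕ → Set} {f : ℕ → ℕ} where

  increasing⇒injective : StrictlyIncreasingOn Q f → InjectiveOn Q f
  increasing⇒injective inc {a} {b} qa qb fa≡fb with <-cmp a b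
  ... | tri< a<b _ _ = ⊥-elim (<-irrefl fa≡fb (inc qa qb a<b))
  ... | tri≈ _ a≡b _ = a≡b
  ... | tri> _ _ b<a = ⊥-elim (<-irrefl (sym fa≡fb) (inc qb qa b<a))

  decreasing⇒injective : StrictlyDecreasingOn Q f → InjectiveOn Q f
  decreasing⇒injective dec {a} {b} qa qb fa≡fb with <-cmp a b
  ... | tri< a<b _ _ = ⊥-elim (<-irrefl (sym fa≡fb) (dec qa qb a<b))
  ... | tri≈ _ a≡b _ = a≡b
  ... | tri> _ _ b<a = ⊥-elim (<-irrefl fa≡fb (dec qb qa b<a))

  <ᵇ-increasing : StrictlyIncreasingOn Q f → ∀ {a b} → Q a → Q b → (f a <ᵇ f b) ≡ (a <ᵇ b)
  <ᵇ-increasing inc {a} {b} qa qb with <-cmp a b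
  ... | tri< a<b _ _ = trans (<ᵇ-true (inc qa qb a<b)) (sym (<ᵇ-true a<b))
  ... | tri≈ _ refl _ = trans (<ᵇ-irrefl (f a)) (sym (<ᵇ-irrefl a))
  ... | tri> _ _ b<a = trans (<ᵇ-false (<⇒≤ (inc qb qa b<a))) (sym (<ᵇ-false (<⇒≤ b<a)))

  <ᵇ-decreasing : StrictlyDecreasingOn Q f → ∀ {a b} → Q a → Q b → (f a <ᵇ f b) ≡ (b <ᵇ a)
  <ᵇ-decreasing dec {a} {b} qa qb with <-cmp a b
  ... | tri< a<b _ _ = trans (<ᵇ-false (<⇒≤ (dec qa qb a<b))) (sym (<ᵇ-false (<⇒≤ a<b)))
  ... | tri≈ _ refl _ = trans (<ᵇ-irrefl (f a)) (sym (<ᵇ-irrefl a))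
  ... | tri> _ _ b<a = trans (<ᵇ-true (dec qb qa b<a)) (sym (<ᵇ-true b<a))

  ≡ᵇ-injective : InjectiveOn Q f → ∀ {a b} → Q a → Q b → (f a ≡ᵇ f b) ≡ (a ≡ᵇ b)
  ≡ᵇ-injective inj {a} {b} qa qb with a ≟ b
  ... | yes refl = trans (≡ᵇ-refl (f a)) (sym (≡ᵇ-refl a))
  ... | no a≢b   = trans (≡ᵇ-false (a≢b ∘ inj qa qb)) (sym (≡ᵇ-false a≢b))

  elemᵇ-map : InjectiveOn Q f → ∀ {a w} → Q a → All Q w → elemᵇ (f a) (map f w) ≡ elemᵇ a w
  elemᵇ-map inj qa []          = refl
  elemᵇ-map inj qa (qx ∷ qw) = cong₂ _∨_ (≡ᵇ-injective inj qa qx) (elemᵇ-map inj qa qw)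

  distinct-map : InjectiveOn Q f → ∀ {w} → All Q w → distinct (map f w) ≡ distinct w
  distinct-map inj []          = refl
  distinct-map inj (qx ∷ qw) = cong₂ (λ b c → not b ∧ c) (elemᵇ-map inj qx qw) (distinct-map inj qw)

  mutual
    isUD-map-increasing : StrictlyIncreasingOn Q f → ∀ {w} → All Q w → isUD (map f w) ≡ isUD w
    isUD-map-increasing inc []                 = refl
    isUD-map-increasing inc (_ ∷ [])           = refl
    isUD-map-increasing inc (qx ∷ qy ∷ qw) =
      cong₂ _∧_ (<ᵇ-increasing inc qx qy) (isDU-map-increasing inc (qy ∷ qw))

    isDU-map-increasing : StrictlyIncreasingOn Q f → ∀ {w} → All Q w → isDU (map f w) ≡ isDU w
    isDU-map-increasing inc []                 = refl
    isDU-map-increasing inc (_ ∷ [])           = refl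
    isDU-map-increasing inc (qx ∷ qy ∷ qw) =
      cong₂ _∧_ (<ᵇ-increasing inc qy qx) (isUD-map-increasing inc (qy ∷ qw))

  mutual
    isUD-map-decreasing : StrictlyDecreasingOn Q f → ∀ {w} → All Q w → isUD (map f w) ≡ isDU w
    isUD-map-decreasing dec []                 = refl
    isUD-map-decreasing dec (_ ∷ [])           = refl
    isUD-map-decreasing dec (qx ∷ qy ∷ qw) =
      cong₂ _∧_ (<ᵇ-decreasing dec qx qy) (isDU-map-decreasing dec (qy ∷ qw))

    isDU-map-decreasing : StrictlyDecreasingOn Q f → ∀ {w} → All Q w → isDU (map f w) ≡ isUD w
    isDU-map-decreasing dec []                 = refl
    isDU-map-decreasing dec (_ ∷ [])           = refl
    isDU-map-decreasing dec (qx ∷ qy ∷ qw) =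
      cong₂ _∧_ (<ᵇ-decreasing dec qy qx) (isUD-map-decreasing dec (qy ∷ qw))

punchIn-increasing : ∀ c → StrictlyIncreasingOn U (punchIn c)
punchIn-increasing c {a} {b} _ _ a<b with a <ᵇ c in a<ᵇc | b <ᵇ c in b<ᵇc
... | true  | true  = a<b
... | true  | false = m<n⇒m<1+n a<b
... | false | true  = ⊥-elim (<-asym (<ᵇ-true⇒< {b} {c} b<ᵇc) (≤-<-trans (<ᵇ-false⇒≥ {a} {c} a<ᵇc) a<b))
... | false | false = s<s a<b

punchIn-≢ : ∀ c x → punchIn c x ≢ c
punchIn-≢ c x with x <ᵇ c in x<ᵇc
... | true  = <⇒≢ (<ᵇ-true⇒< x<ᵇc)
... | false = λ sx≡c → 1+n≰n (subst (_≤ x) (sym sx≡c) (<ᵇ-false⇒≥ x<ᵇc))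

punchIn-< : ∀ c {l x} → x < l → punchIn c x < suc l
punchIn-< c {x = x} x<l with x <ᵇ c
... | true  = m<n⇒m<1+n x<l
... | false = s<s x<l

punchOut : ℕ → ℕ → ℕ
punchOut c v = if c <ᵇ v then pred v else v

punchOut-increasing : ∀ c → StrictlyIncreasingOn (_≢ c) (punchOut c)
punchOut-increasing c {a} {b} a≢c _ a<b with c <ᵇ a in c<ᵇa | c <ᵇ b in c<ᵇb
... | true  | true  = pred-< (<ᵇ-true⇒< c<ᵇa) a<b
  where
  pred-< : ∀ {c a b} → c < a → a < b → pred a < pred b
  pred-< {a = suc _} {b = suc _} _ = s<s⁻¹
... | true  | false = ⊥-elim (<-asym (<ᵇ-true⇒< c<ᵇa) (<-≤-trans a<b (<ᵇ-false⇒≥ c<ᵇb)))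
... | false | true  = <-≤-trans (≤∧≢⇒< (<ᵇ-false⇒≥ c<ᵇa) a≢c) (pred-mono-≤ (<ᵇ-true⇒< {c} {b} c<ᵇb))
... | false | false = a<b

punchOut-< : ∀ {c k v} → c < suc k → v < suc k → v ≢ c → punchOut c v < k
punchOut-< {c} {k} {v} c≤k v≤k v≢c with c <ᵇ v in c<ᵇv
... | true  = pred-< (<ᵇ-true⇒< c<ᵇv) v≤k
  where
  pred-< : ∀ {c v} → c < v → v < suc k → pred v < k
  pred-< {v = suc _} _ = s≤s⁻¹
... | false = <-≤-trans (≤∧≢⇒< (<ᵇ-false⇒≥ c<ᵇv) v≢c) (s≤s⁻¹ c≤k)

distinct⇒length≤ : ∀ {k} w → distinct w ≡ true → All (_< k) w → length w ≤ k
distinct⇒length≤         []      _ _             = z≤n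
distinct⇒length≤ {suc k} (x ∷ w) d (x<k ∷ w<k) =
  s≤s (subst (_≤ k) (length-map (punchOut x) w) (distinct⇒length≤ (map (punchOut x) w) d′ w′<k))
  where
  w≢x : All (_≢ x) w
  w≢x = elemᵇ-false⇒All≢ x w (not-injective (∧-conicalˡ _ _ d))
  d′ : distinct (map (punchOut x) w) ≡ true
  d′ = trans (distinct-map (increasing⇒injective (punchOut-increasing x)) w≢x) (∧-conicalʳ _ _ d)
  w′<k : All (_< k) (map (punchOut x) w)
  w′<k = map⁺ (All.zipWith (λ (v<k , v≢x) → punchOut-< x<k v<k v≢x) (w<k , w≢x))

distinct⇒elemᵇ-max : ∀ m w → distinct w ≡ true → All (_< suc m) w → length w ≡ suc m → elemᵇ m w ≡ true
distinct⇒elemᵇ-max m w d w≤m |w| with elemᵇ m w in m∈w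
... | true  = refl
... | false = ⊥-elim (1+n≰n (subst (_≤ m) |w| (distinct⇒length≤ w d (All<-strengthen m w w≤m m∈w))))

max∈prefix : ∀ m w v → distinct (w ++ v) ≡ true → length (w ++ v) ≡ suc m →
             All (_< suc m) w → All (_< m) v → elemᵇ m w ≡ true
max∈prefix m w v d |wv| w≤m v<m = trans (sym (elemᵇ-++-∉ m w v (All≢⇒elemᵇ-false (All.map <⇒≢ v<m))))
  (distinct⇒elemᵇ-max m (w ++ v) d (++⁺ w≤m (All.map m<n⇒m<1+n v<m)) |wv|)

-- The statistic mmp

any-elemᵇ : ∀ (p : ℕ → Bool) {m} xs → p m ≡ true → elemᵇ m xs ≡ true → any p xs ≡ true
any-elemᵇ p {m} (y ∷ ys) pm m∈ with m ≡ᵇ y in m≡ᵇy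
... | true  rewrite sym (≡ᵇ-true⇒≡ {m} {y} m≡ᵇy) | pm = refl
... | false rewrite any-elemᵇ p ys pm m∈ = ∨-zeroʳ (p y)

any-false : ∀ (p : ℕ → Bool) {xs} → All (λ x → p x ≡ false) xs → any p xs ≡ false
any-false p []              = refl
any-false p (py≡f ∷ pys≡f) rewrite py≡f = any-false p pys≡f

mmp-++-≤ : ∀ w t → mmp (w ++ t) ≤ length w + mmp t
mmp-++-≤ []      t = ≤-refl
mmp-++-≤ (y ∷ w) t = +-mono-≤ (𝟙≤1 _) (mmp-++-≤ w t)

-- An occurrence of the maximum m in w never counts: no later letter exceeds it.
mmp-++-< : ∀ m w t → elemᵇ m w ≡ true → All (_< suc m) (w ++ t) → mmp (w ++ t) < length w + mmp t
mmp-++-< m (y ∷ w) t m∈ (_ ∷ w≤m) with m ≡ᵇ y in m≡ᵇy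
... | true  rewrite sym (≡ᵇ-true⇒≡ {m} {y} m≡ᵇy)
                  | any-false (m <ᵇ_) (All.map (<ᵇ-false ∘ s≤s⁻¹) w≤m) = s≤s (mmp-++-≤ w t)
... | false = +-mono-≤-< (𝟙≤1 _) (mmp-++-< m w t m∈ w≤m)

mmp-++-≡ : ∀ m w t → All (_< m) w → elemᵇ m t ≡ true → mmp (w ++ t) ≡ length w + mmp t
mmp-++-≡ m []      t []            m∈ = refl
mmp-++-≡ m (y ∷ w) t (y<m ∷ w<m) m∈
  rewrite any-elemᵇ (y <ᵇ_) (w ++ t) (<ᵇ-true y<m) (elemᵇ-++ʳ m w t m∈) = cong suc (mmp-++-≡ m w t w<m m∈)

mmp-descent : ∀ {x y} → y < x → mmp (x ∷ [ y ]) ≡ 0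
mmp-descent y<x rewrite <ᵇ-false (<⇒≤ y<x) = refl

-- Alternating words

mutual
  even : ℕ → Bool
  even zero    = true
  even (suc n) = odd n

  odd : ℕ → Bool
  odd zero    = false
  odd (suc n) = even n

even-2* : ∀ k → T (even (2 * k))
even-2* zero    = _
even-2* (suc k) = subst (T ∘ even) (sym (*-suc 2 k)) (even-2* k)

mutual
  isUD-∷ʳ-max : ∀ {a} w → T (odd (length w)) → All (_< a) w → isUD (w ++ [ a ]) ≡ isUD w
  isUD-∷ʳ-max (x ∷ [])    _ (x<a ∷ [])  rewrite <ᵇ-true x<a = refl
  isUD-∷ʳ-max (x ∷ z ∷ r) p (_ ∷ zr<a) = cong ((x <ᵇ z) ∧_) (isDU-∷ʳ-max (z ∷ r) p zr<a)

  isDU-∷ʳ-max : ∀ {a} w → T (even (length w)) → All (_< a) w → isDU (w ++ [ a ]) ≡ isDU w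
  isDU-∷ʳ-max []          _ _           = refl
  isDU-∷ʳ-max (x ∷ z ∷ r) p (_ ∷ zr<a) = cong ((z <ᵇ x) ∧_) (isUD-∷ʳ-max (z ∷ r) p zr<a)

mutual
  isUD-++-∷ : ∀ a v w → T (odd (length w)) → isUD (w ++ a ∷ v) ≡ (isUD (w ++ [ a ]) ∧ isDU (a ∷ v))
  isUD-++-∷ a v (x ∷ [])    _ = cong (_∧ isDU (a ∷ v)) (sym (∧-identityʳ (x <ᵇ a)))
  isUD-++-∷ a v (x ∷ z ∷ r) p =
    trans (cong ((x <ᵇ z) ∧_) (isDU-++-∷ a v (z ∷ r) p)) (sym (∧-assoc (x <ᵇ z) _ _))

  isDU-++-∷ : ∀ a v w → T (even (length w)) → isDU (w ++ a ∷ v) ≡ (isDU (w ++ [ a ]) ∧ isDU (a ∷ v))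
  isDU-++-∷ a v []          _ = refl
  isDU-++-∷ a v (x ∷ z ∷ r) p =
    trans (cong ((z <ᵇ x) ∧_) (isUD-++-∷ a v (z ∷ r) p)) (sym (∧-assoc (z <ᵇ x) _ _))

count-DU≡count-UD : ∀ n → count isDU n ≡ count isUD n
count-DU≡count-UD n = begin
  count isDU n                                             ≡⟨ count≡∑-words isDU n ⟩
  ∑ₗ (countWeight isDU) (words n n)                        ≡⟨ ∑-words-reverse n n _ ⟩
  ∑ₗ (countWeight isDU ∘ map (λ v → n ∸ suc v)) (words n n) ≡⟨ ∑-words-cong n n complement ⟩
  ∑ₗ (countWeight isUD) (words n n)                        ≡⟨ count≡∑-words isUD n ⟨
  count isUD n                                             ∎
  where
  open ≡-Reasoning
  decreasing : StrictlyDecreasingOn (_< n) (λ v → n ∸ suc v)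
  decreasing _ b<n a<b = ∸-monoʳ-< (s<s a<b) b<n
  complement : ∀ w → length w ≡ n → All (_< n) w →
               countWeight isDU (map (λ v → n ∸ suc v) w) ≡ countWeight isUD w
  complement w _ w<n = cong₂ (λ b c → if b then 𝟙 c else 0)
    (distinct-map (decreasing⇒injective decreasing) w<n) (isDU-map-decreasing decreasing w<n)

zigzag : ℕ → List ℕ
zigzag zero          = []
zigzag (suc zero)    = [ 0 ]
zigzag (suc (suc m)) = m ∷ suc m ∷ zigzag m

zigzag-up-down : ∀ m → length (zigzag m) ≡ m × All (_< m) (zigzag m)
                      × distinct (zigzag m) ≡ true × isUD (zigzag m) ≡ true
zigzag-up-down zero          = refl , [] , refl , refl
zigzag-up-down (suc zero)    = refl , z<s ∷ [] , refl , refl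
zigzag-up-down (suc (suc m)) with zigzag-up-down m
... | |z| , z<m , d , ud =
  cong (suc ∘ suc) |z| , m<n⇒m<1+n (n<1+n m) ∷ n<1+n (suc m) ∷ All.map (m<n⇒m<1+n ∘ m<n⇒m<1+n) z<m , distinct′ , up-down
  where
  distinct′ : distinct (m ∷ suc m ∷ zigzag m) ≡ true
  distinct′ rewrite ≡ᵇ-false {m} {suc m} (<⇒≢ (n<1+n m))
                  | All≢⇒elemᵇ-false {m} (All.map <⇒≢ z<m)
                  | All≢⇒elemᵇ-false {suc m} (All.map (<⇒≢ ∘ m<n⇒m<1+n) z<m) | d = refl
  down-up : ∀ r → All (_< m) r → isUD r ≡ true → isDU (suc m ∷ r) ≡ true
  down-up []      _         _  = refl
  down-up (x ∷ r) (x<m ∷ _) ud′ rewrite <ᵇ-true (m<n⇒m<1+n x<m) = ud′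
  up-down : isUD (m ∷ suc m ∷ zigzag m) ≡ true
  up-down rewrite <ᵇ-true (n<1+n m) = down-up (zigzag m) z<m ud

udCount≢0 : ∀ n → udCount n ≢ 0
udCount≢0 n udCount≡0 with zigzag-up-down n
... | |z| , z<n , d , ud = 1+n≰n (begin
  1                                   ≡⟨ weight≡1 ⟨
  countWeight isUD (zigzag n)         ≤⟨ ≤-∑-words n n (countWeight isUD) |z| z<n ⟩
  ∑ₗ (countWeight isUD) (words n n)  ≡⟨ count≡∑-words isUD n ⟨
  udCount n                           ≡⟨ udCount≡0 ⟩
  0                                   ∎)
  where
  open ≤-Reasoning
  weight≡1 : countWeight isUD (zigzag n) ≡ 1
  weight≡1 rewrite d | ud = refl

-- Leading coefficients

length-++-suffix : ∀ (w v : List ℕ) {l} → length w ≡ l → length (w ++ v) ≡ length v + l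
length-++-suffix w v refl = trans (length-++ w) (+-comm (length w) (length v))

module _ (P : List ℕ → Bool) (m : ℕ) where

  coeff-∷ʳ-above : ∀ j → m < j → coeff P (suc m) j ≡ 0
  coeff-∷ʳ-above j m<j = begin
    coeff P (suc m) j
      ≡⟨ coeff≡∑-words P (suc m) j ⟩
    ∑ₗ (coeffWeight P j) (words (suc m) (suc m))
      ≡⟨ ∑-words-∷ʳ _ (suc m) m ⟩
    ∑ₗ (λ w → ∑ (suc m) (λ x → coeffWeight P j (w ++ [ x ]))) (words (suc m) m)
      ≡⟨ ∑-words-cong (suc m) m vanish ⟩
    ∑ₗ (const 0) (words (suc m) m)
      ≡⟨ ∑ₗ-zero (words (suc m) m) ⟩
    0 ∎
    where
    open ≡-Reasoning
    vanish : ∀ w → length w ≡ m → All (_< suc m) w → ∑ (suc m) (λ x → coeffWeight P j (w ++ [ x ])) ≡ 0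
    vanish w |w| _ = ∑-zero (suc m) _ (λ x _ →
      coeffWeight-≢ P j (w ++ [ x ]) (λ _ _ → <⇒≢ (≤-<-trans (mmp≤m x) m<j)))
      where
      mmp≤m : ∀ x → mmp (w ++ [ x ]) ≤ m
      mmp≤m x = subst (mmp (w ++ [ x ]) ≤_) (trans (+-identityʳ _) |w|) (mmp-++-≤ w [ x ])

  top-weight-∷ʳ : ∀ w → length w ≡ m → All (_< suc m) w →
                  ∑ (suc m) (λ x → coeffWeight P m (w ++ [ x ])) ≡ countWeight P (w ++ [ m ])
  top-weight-∷ʳ w |w| w≤m = trans (∑-last m (λ x → coeffWeight P m (w ++ [ x ]))
                                          (λ x x<m → coeffWeight-≢ P m (w ++ [ x ]) (λ d _ → <⇒≢ (mmp<m x<m d))))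
                                  (coeffWeight-≡ P m (w ++ [ m ]) mmp≡m)
    where
    mmp<m : ∀ {x} → x < m → distinct (w ++ [ x ]) ≡ true → mmp (w ++ [ x ]) < m
    mmp<m {x} x<m d = subst (mmp (w ++ [ x ]) <_) (trans (+-identityʳ _) |w|)
      (mmp-++-< m w [ x ] (max∈prefix m w [ x ] d (length-++-suffix w [ x ] |w|) w≤m (x<m ∷ []))
                          (++⁺ w≤m (m<n⇒m<1+n x<m ∷ [])))
    mmp≡m : distinct (w ++ [ m ]) ≡ true → mmp (w ++ [ m ]) ≡ m
    mmp≡m d = trans (mmp-++-≡ m w [ m ] (All<-strengthen m w w≤m (distinct-++-∷⇒∉ m w [] d)) (elemᵇ-here m []))
                    (trans (+-identityʳ _) |w|)

  module _ (P-∷ʳ-max : ∀ w → length w ≡ m → All (_< m) w → P (w ++ [ m ]) ≡ P w) where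

    ∑-words-∷ʳ-max : ∑ₗ (λ w → countWeight P (w ++ [ m ])) (words (suc m) m) ≡ ∑ₗ (countWeight P) (words m m)
    ∑-words-∷ʳ-max = trans (∑-words-restrict m m _ max∈w) (∑-words-cong m m drop-max)
      where
      max∈w : ∀ w → elemᵇ m w ≡ true → countWeight P (w ++ [ m ]) ≡ 0
      max∈w w m∈w rewrite distinct-∷ʳ m w | m∈w = refl
      drop-max : ∀ w → length w ≡ m → All (_< m) w → countWeight P (w ++ [ m ]) ≡ countWeight P w
      drop-max w |w| w<m
        rewrite distinct-∷ʳ m w | All≢⇒elemᵇ-false {m} (All.map <⇒≢ w<m) | P-∷ʳ-max w |w| w<m = refl

    coeff-∷ʳ-max : coeff P (suc m) m ≡ count P m
    coeff-∷ʳ-max = begin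
      coeff P (suc m) m
        ≡⟨ coeff≡∑-words P (suc m) m ⟩
      ∑ₗ (coeffWeight P m) (words (suc m) (suc m))
        ≡⟨ ∑-words-∷ʳ _ (suc m) m ⟩
      ∑ₗ (λ w → ∑ (suc m) (λ x → coeffWeight P m (w ++ [ x ]))) (words (suc m) m)
        ≡⟨ ∑-words-cong (suc m) m top-weight-∷ʳ ⟩
      ∑ₗ (λ w → countWeight P (w ++ [ m ])) (words (suc m) m)
        ≡⟨ ∑-words-∷ʳ-max ⟩
      ∑ₗ (countWeight P) (words m m)
        ≡⟨ count≡∑-words P m ⟨
      count P m ∎
      where open ≡-Reasoning

    highestTerm-∷ʳ-max : ∀ {c} → count P m ≡ c → c ≢ 0 → HighestTerm (coeff P (suc m)) m c
    highestTerm-∷ʳ-max count≡c c≢0 = trans coeff-∷ʳ-max count≡c , c≢0 , coeff-∷ʳ-above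

module _ (P : List ℕ → Bool) (l : ℕ)
         (P-++-∷ : ∀ a v w → length w ≡ l → P (w ++ a ∷ v) ≡ (P (w ++ [ a ]) ∧ isDU (a ∷ v))) where

  private
    m = suc l
    K = suc m

  descent : ∀ {x y} w → length w ≡ l → P (w ++ x ∷ [ y ]) ≡ true → y < x
  descent {x} {y} w |w| p =
    <ᵇ-true⇒< (∧-conicalˡ (y <ᵇ x) true (∧-conicalʳ (P (w ++ [ x ])) _ (trans (sym (P-++-∷ x [ y ] w |w|)) p)))

  mmp-++-descent : ∀ {x y} (w : List ℕ) → length w ≡ l → y < x → length w + mmp (x ∷ [ y ]) ≡ l
  mmp-++-descent w |w| y<x = trans (cong (length w +_) (mmp-descent y<x)) (trans (+-identityʳ _) |w|)

  coeff-∷ʳ-∷ʳ-above : ∀ j → l < j → coeff P K j ≡ 0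
  coeff-∷ʳ-∷ʳ-above j l<j = begin
    coeff P K j
      ≡⟨ coeff≡∑-words P K j ⟩
    ∑ₗ (coeffWeight P j) (words K K)
      ≡⟨ ∑-words-∷ʳ-∷ʳ _ K l ⟩
    ∑ₗ (λ w → ∑ K (λ x → ∑ K (λ y → coeffWeight P j (w ++ x ∷ [ y ])))) (words K l)
      ≡⟨ ∑-words-cong K l vanish ⟩
    ∑ₗ (const 0) (words K l)
      ≡⟨ ∑ₗ-zero (words K l) ⟩
    0 ∎
    where
    open ≡-Reasoning
    vanish : ∀ w → length w ≡ l → All (_< K) w → ∑ K (λ x → ∑ K (λ y → coeffWeight P j (w ++ x ∷ [ y ]))) ≡ 0
    vanish w |w| _ = ∑-zero K _ (λ x _ → ∑-zero K _ (λ y _ → coeffWeight-≢ P j (w ++ x ∷ [ y ]) (λ _ p →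
      let y<x = descent w |w| p in
      <⇒≢ (≤-<-trans (subst (_ ≤_) (mmp-++-descent w |w| y<x) (mmp-++-≤ w (x ∷ [ y ]))) l<j))))

  top-weight-∷ʳ-∷ʳ : ∀ w → length w ≡ l → All (_< K) w →
                     ∑ K (λ x → ∑ K (λ y → coeffWeight P l (w ++ x ∷ [ y ]))) ≡
                     ∑ m (λ y → countWeight P (w ++ m ∷ [ y ]))
  top-weight-∷ʳ-∷ʳ w |w| w≤m = begin
    ∑ K (λ x → ∑ K (λ y → coeffWeight P l (w ++ x ∷ [ y ])))
      ≡⟨ ∑-last m (λ x → ∑ K (λ y → coeffWeight P l (w ++ x ∷ [ y ])))
                  (λ x x<m → ∑-zero K _ (λ y _ → coeffWeight-≢ P l (w ++ x ∷ [ y ])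
                                                   (λ d p → <⇒≢ (mmp<l x<m (descent w |w| p) d)))) ⟩
    ∑ K (λ y → coeffWeight P l (w ++ m ∷ [ y ]))
      ≡⟨ ∑-suc m (λ y → coeffWeight P l (w ++ m ∷ [ y ])) ⟩
    ∑ m (λ y → coeffWeight P l (w ++ m ∷ [ y ])) + coeffWeight P l (w ++ m ∷ [ m ])
      ≡⟨ cong₂ _+_ (∑-cong m (λ y y<m → coeffWeight-≡ P l (w ++ m ∷ [ y ]) (mmp≡l y<m))) repeated-max ⟩
    ∑ m (λ y → countWeight P (w ++ m ∷ [ y ])) + 0
      ≡⟨ +-identityʳ _ ⟩
    ∑ m (λ y → countWeight P (w ++ m ∷ [ y ])) ∎
    where
    open ≡-Reasoning
    mmp<l : ∀ {x y} → x < m → y < x → distinct (w ++ x ∷ [ y ]) ≡ true → mmp (w ++ x ∷ [ y ]) < l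
    mmp<l {x} {y} x<m y<x d = subst (mmp (w ++ x ∷ [ y ]) <_) (mmp-++-descent w |w| y<x)
      (mmp-++-< m w (x ∷ [ y ]) (max∈prefix m w (x ∷ [ y ]) d (length-++-suffix w (x ∷ [ y ]) |w|) w≤m xy<m)
                                (++⁺ w≤m (All.map m<n⇒m<1+n xy<m)))
      where
      xy<m : All (_< m) (x ∷ [ y ])
      xy<m = x<m ∷ <-trans y<x x<m ∷ []
    mmp≡l : ∀ {y} → y < m → distinct (w ++ m ∷ [ y ]) ≡ true → mmp (w ++ m ∷ [ y ]) ≡ l
    mmp≡l {y} y<m d = trans (mmp-++-≡ m w (m ∷ [ y ]) (All<-strengthen m w w≤m (distinct-++-∷⇒∉ m w [ y ] d))
                                                    (elemᵇ-here m [ y ]))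
                            (mmp-++-descent w |w| y<m)
    repeated-max : coeffWeight P l (w ++ m ∷ [ m ]) ≡ 0
    repeated-max = coeffWeight-≢ P l (w ++ m ∷ [ m ]) (λ d _ →
      ⊥-elim (not-distinct (distinct-++⇒distinctʳ w (m ∷ [ m ]) d)))
      where
      not-distinct : distinct (m ∷ [ m ]) ≢ true
      not-distinct rewrite ≡ᵇ-refl m = λ ()

  module _ (P-∷ʳ-max : ∀ {a} w → length w ≡ l → All (_< a) w → P (w ++ [ a ]) ≡ P w)
           (P-punchIn : ∀ c w → P (map (punchIn c) w) ≡ P w) where

    P-∷ʳ-max-descent : ∀ {a y} w → length w ≡ l → All (_< a) w → y < a → P (w ++ a ∷ [ y ]) ≡ P w
    P-∷ʳ-max-descent {a} {y} w |w| w<a y<a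
      rewrite P-++-∷ a [ y ] w |w| | P-∷ʳ-max w |w| w<a | <ᵇ-true y<a = ∧-identityʳ (P w)

    ∑-words-max-∷ : ∀ {y} → y < m →
                    ∑ₗ (λ w → countWeight P (w ++ m ∷ [ y ])) (words K l) ≡ ∑ₗ (countWeight P) (words l l)
    ∑-words-max-∷ {y} y<m = begin
      ∑ₗ H (words K l)                       ≡⟨ ∑-words-restrict m l H m∈w ⟩
      ∑ₗ H (words m l)                       ≡⟨ ∑-words-punchIn l H (s≤s⁻¹ y<m) y∈w ⟩
      ∑ₗ (H ∘ map (punchIn y)) (words l l)   ≡⟨ ∑-words-cong l l punchIn-invariant ⟩
      ∑ₗ (countWeight P) (words l l)         ∎
      where
      open ≡-Reasoning
      H : List ℕ → ℕ
      H w = countWeight P (w ++ m ∷ [ y ])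
      m∈w : ∀ w → elemᵇ m w ≡ true → H w ≡ 0
      m∈w w m∈w = countWeight-¬distinct P (w ++ m ∷ [ y ]) (λ d →
        subst T (distinct-++-∷⇒∉ m w [ y ] d) (Equivalence.from T-≡ m∈w))
      y∈w : ∀ w → elemᵇ y w ≡ true → H w ≡ 0
      y∈w w y∈w = countWeight-¬distinct P (w ++ m ∷ [ y ]) (λ d →
        subst T (distinct-++-∷⇒∉ y (w ++ [ m ]) [] (subst (λ σ → distinct σ ≡ true) (sym (∷ʳ-++ w m [ y ])) d))
                (Equivalence.from T-≡ (elemᵇ-++ˡ y w [ m ] y∈w)))
      punchIn-invariant : ∀ w → length w ≡ l → All (_< l) w → H (map (punchIn y) w) ≡ countWeight P w
      punchIn-invariant w |w| w<l = cong₂ (λ b c → if b then 𝟙 c else 0)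
        (trans (distinct-++-max-∷ w′ w′<m y<m y∉w′)
               (distinct-map (increasing⇒injective (punchIn-increasing y)) (All.universal-U w)))
        (trans (P-∷ʳ-max-descent w′ (trans (length-map (punchIn y) w) |w|) w′<m y<m) (P-punchIn y w))
        where
        w′ = map (punchIn y) w
        w′<m : All (_< m) w′
        w′<m = map⁺ (All.map (punchIn-< y) w<l)
        y∉w′ : elemᵇ y w′ ≡ false
        y∉w′ = All≢⇒elemᵇ-false (map⁺ (All.universal (punchIn-≢ y) w))

    coeff-∷ʳ-max-∷ʳ : coeff P K l ≡ m * count P l
    coeff-∷ʳ-max-∷ʳ = begin
      coeff P K l
        ≡⟨ coeff≡∑-words P K l ⟩
      ∑ₗ (coeffWeight P l) (words K K)
        ≡⟨ ∑-words-∷ʳ-∷ʳ _ K l ⟩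
      ∑ₗ (λ w → ∑ K (λ x → ∑ K (λ y → coeffWeight P l (w ++ x ∷ [ y ])))) (words K l)
        ≡⟨ ∑-words-cong K l top-weight-∷ʳ-∷ʳ ⟩
      ∑ₗ (λ w → ∑ m (λ y → countWeight P (w ++ m ∷ [ y ]))) (words K l)
        ≡⟨ ∑ₗ-∑-comm m (λ y w → countWeight P (w ++ m ∷ [ y ])) (words K l) ⟩
      ∑ m (λ y → ∑ₗ (λ w → countWeight P (w ++ m ∷ [ y ])) (words K l))
        ≡⟨ ∑-cong m (λ _ → ∑-words-max-∷) ⟩
      ∑ m (const (∑ₗ (countWeight P) (words l l)))
        ≡⟨ ∑-const m _ ⟩
      m * ∑ₗ (countWeight P) (words l l)
        ≡⟨ cong (m *_) (count≡∑-words P l) ⟨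
      m * count P l ∎
      where open ≡-Reasoning

    highestTerm-∷ʳ-max-∷ʳ : ∀ {c} → count P l ≡ c → c ≢ 0 → HighestTerm (coeff P K) l (m * c)
    highestTerm-∷ʳ-max-∷ʳ count≡c c≢0 =
      trans coeff-∷ʳ-max-∷ʳ (cong (m *_) count≡c) , c≢0 ∘ m+n≡0⇒m≡0 _ , coeff-∷ʳ-∷ʳ-above

module _ (l : ℕ) where

  highestTerm-A : T (odd l) → HighestTerm (polyUD (suc l)) l (udCount l)
  highestTerm-A odd-l = highestTerm-∷ʳ-max isUD l (λ w |w| → isUD-∷ʳ-max w (subst (T ∘ odd) (sym |w|) odd-l))
                                           refl (udCount≢0 l)

  highestTerm-B : T (odd l) → HighestTerm (polyUD (suc (suc l))) l (suc l * udCount l)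
  highestTerm-B odd-l = highestTerm-∷ʳ-max-∷ʳ isUD l
    (λ a v w |w| → isUD-++-∷ a v w (subst (T ∘ odd) (sym |w|) odd-l))
    (λ w |w| → isUD-∷ʳ-max w (subst (T ∘ odd) (sym |w|) odd-l))
    (λ c w → isUD-map-increasing (punchIn-increasing c) (All.universal-U w))
    refl (udCount≢0 l)

  highestTerm-C : T (even l) → HighestTerm (polyDU (suc (suc l))) l (suc l * udCount l)
  highestTerm-C even-l = highestTerm-∷ʳ-max-∷ʳ isDU l
    (λ a v w |w| → isDU-++-∷ a v w (subst (T ∘ even) (sym |w|) even-l))
    (λ w |w| → isDU-∷ʳ-max w (subst (T ∘ even) (sym |w|) even-l))
    (λ c w → isDU-map-increasing (punchIn-increasing c) (All.universal-U w))
    (count-DU≡count-UD l) (udCount≢0 l)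

  highestTerm-D : T (even l) → HighestTerm (polyDU (suc l)) l (udCount l)
  highestTerm-D even-l = highestTerm-∷ʳ-max isDU l (λ w |w| → isDU-∷ʳ-max w (subst (T ∘ even) (sym |w|) even-l))
                                            (count-DU≡count-UD l) (udCount≢0 l)

TopTerms : ℕ → Set
TopTerms N = HighestTerm (polyUD N) (N ∸ 1) (udCount (N ∸ 1))
           × HighestTerm (polyUD (N + 1)) (N ∸ 1) (N * udCount (N ∸ 1))
           × HighestTerm (polyDU N) (N ∸ 2) ((N ∸ 1) * udCount (N ∸ 2))
           × HighestTerm (polyDU (N + 1)) N (udCount N)

topTerms : ∀ t → T (even t) → TopTerms (2 + t)
topTerms t even-t rewrite +-comm t 1 =
  highestTerm-A (suc t) even-t , highestTerm-B (suc t) even-t , highestTerm-C t even-t , highestTerm-D (2 + t) even-t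

proposition3p2 : (n : ℕ) → 1 ≤ n →
      HighestTerm (polyUD (2 * n)) (2 * n ∸ 1) (udCount (2 * n ∸ 1))
    × HighestTerm (polyUD (2 * n + 1)) (2 * n ∸ 1) ((2 * n) * udCount (2 * n ∸ 1))
    × HighestTerm (polyDU (2 * n)) (2 * n ∸ 2) ((2 * n ∸ 1) * udCount (2 * n ∸ 2))
    × HighestTerm (polyDU (2 * n + 1)) (2 * n) (udCount (2 * n))
proposition3p2 (suc k) _ = subst TopTerms (sym (*-suc 2 k)) (topTerms (2 * k) (even-2* k))
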